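{- The History Coverability problem (HCOV) is decidable for Petri nets with history: given a Petri net $\langle P,T,M_0\rangle$ with history, a marking $M_1$ and a word $w$ over transition-name events, it is decidable whether there is a computation from $M_0[\epsilon]$ reaching some configuration $M[h]$ such that $M_1\sqsubseteq M$ (multiset inclusion) and $w$ is a (scattered) subword of $h$.
   Context: A Petri net is a tuple $\langle P,T,M_0\rangle$ with $P$ a finite set of places, $T$ a finite set of transitions, and $M_0$ an initial marking. A marking is a multiset over $P$ (a map $P\to\mathbb{N}$); $\sqsubseteq$ denotes multiset inclusion, $\oplus$ multiset union and $\ominus$ multiset difference. Each transition is $t=\langle Pre,Post\rangle$ with $Pre,Post$ multisets over $P$; $t$ is enabled at $M$ if $Pre\sqsubseteq M$, and firing it yields $(M\ominus Pre)\oplus Post$. In a Petri net with history, each transition $t$ emits an event $h_t$ (its name), and configurations are pairs $M[h]$ where $M$ is a marking and $h$ is a finite word over the finite alphabet $\{h_t\mid t\in T\}$; the step relation is $(Pre\oplus M)[h]\triangleright(Post\oplus M)[h_t.h]$ for each $t=\langle Pre,Post\rangle\in T$ and marking $M$, where $h_t.h$ is the word obtained by prepending $h_t$ to $h$. A computation is a sequence of such steps starting from $M_0[\epsilon]$ ($\epsilon$ the empty word). Histories are ordered by the subword (scattered subsequence) relation. -}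

module Defs where

open import Data.Nat using (ℕ; _+_; _∸_; _≤_)
open import Data.Fin using (Fin)
open import Data.List using (List; []; _∷_)
open import Data.Product using (_×_; _,_; ∃-syntax)
open import Relation.Binary.Construct.Closure.ReflexiveTransitive using (Star)
open import Data.List.Relation.Binary.Sublist.Propositional using (_⊆_)

Marking : ℕ → Set
Marking p = Fin p → ℕ

_⊑_ : ∀ {p} → Marking p → Marking p → Set
M ⊑ M' = ∀ i → M i ≤ M' i

record PetriNet : Set where
  field
    places      : ℕ
    transitions : ℕ
    pre         : Fin transitions → Marking places
    post        : Fin transitions → Marking places
    M₀          : Marking places
open PetriNet public

-- Histories: finite words over the event alphabet {h_t | t ∈ T};
-- the event h_t emitted by t is its name, identified with t itself.
History : PetriNet → Set
History N = List (Fin (transitions N))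

Config : PetriNet → Set
Config N = Marking (places N) × History N

-- Firing t at M: (M ⊖ Pre) ⊕ Post  (used only when Pre ⊑ M)
fire : (N : PetriNet) → Fin (transitions N) → Marking (places N) → Marking (places N)
fire N t M i = (M i ∸ pre N t i) + post N t i

-- One step: (Pre ⊕ M)[h] ▷ (Post ⊕ M)[h_t.h]
data Step (N : PetriNet) : Config N → Config N → Set where
  step : ∀ (t : Fin (transitions N)) {M : Marking (places N)} {h : History N} →
         pre N t ⊑ M → Step N (M , h) (fire N t M , t ∷ h)

_▷*_ : {N : PetriNet} → Config N → Config N → Set
_▷*_ {N} = Star (Step N)

HistoryCoverable : (N : PetriNet) → Marking (places N) → History N → Set
HistoryCoverable N M₁ w =
  ∃[ M ] ∃[ h ] (_▷*_ {N} (M₀ N , []) (M , h) × M₁ ⊑ M × w ⊆ h)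

-- When events are prepended to a history, matching w greedily from its right end is
-- optimal: w ⊆ h iff the greedy matcher consumes all of w. The matcher is a finite
-- automaton whose state k (the length of the still unmatched prefix of w) can only
-- decrease, and firing from a larger state leaves at least as large a state. So HCOV is
-- coverability of (M₁ , 0) in the product of the net with this automaton, ordered by
-- (M , k) ≼ (M′ , k′) iff M ⊑ M′ and k′ ≤ k. This product is well structured: steps are
-- monotone, ≼ is a well-quasi-order on the states with k ≤ |w| by Dickson's lemma, and
-- each transition has a single minimal predecessor of any upward closed cone. Hence the
-- backward saturation algorithm computes a finite basis of the coverable states.
module Submission where

open import Defs
open import Data.Empty using (⊥-elim)
open import Data.Fin as Fin using (Fin; zero; suc; toℕ; fromℕ<; punchOut)
open import Data.Fin.Properties using (all?; ¬∀⟶∃¬; punchIn-punchOut; toℕ-fromℕ<)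
open import Data.List using (List; []; _∷_; map; drop; length)
open import Data.List.Properties using (≡-dec; length-drop; drop-all)
open import Data.List.Membership.Propositional using (_∈_; find)
open import Data.List.Relation.Binary.Subset.Propositional as Subset using ()
open import Data.List.Relation.Binary.Subset.Propositional.Properties
  using (⊆-refl; ⊆-trans; xs⊆x∷xs; ∷⁺ʳ)
open import Data.List.Relation.Binary.Sublist.Propositional using (_⊆_; []; _∷_; _∷ʳ_)
open import Data.List.Relation.Unary.All as All using (All; []; _∷_)
open import Data.List.Relation.Unary.All.Properties using (anti-mono; map⁺; ¬Any⇒All¬; ¬All⇒Any¬)
open import Data.List.Relation.Unary.Any as Any using (Any; here; there)
open import Data.Nat using (ℕ; zero; suc; _+_; _∸_; _≤_; _<_; z≤n; s≤s)
open import Data.Nat.Properties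
open import Data.Product using (_×_; _,_; proj₁; ∃-syntax)
open import Data.Sum using (_⊎_; inj₁; inj₂; [_,_])
open import Data.Unit using (tt)
open import Data.Vec.Functional using (removeAt) renaming (_∷_ to _◂_)
open import Function using (_∘_; _⇔_; mk⇔)
open import Relation.Binary.Construct.Closure.ReflexiveTransitive using (Star; ε; _◅_)
open import Relation.Binary.Definitions using (Reflexive; Transitive; Decidable; DecidableEquality)
open import Relation.Binary.PropositionalEquality using (_≡_; refl; sym; trans; cong; subst)
open import Relation.Nullary using (Dec; yes; no; ¬_)
open import Relation.Nullary.Decidable as Dec using (_×-dec_; map′)
open import Relation.Nullary.Negation using (contradiction)
open import Relation.Unary using (Pred; U; _∪_; _∩_; _≐_)

-- Bar R P L: every sequence extending L by elements that satisfy P and lie R-above no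
-- earlier element is finite. Bar R U [] says that R is a well-quasi-order.
data Bar {A : Set} (R : A → A → Set) (P : Pred A _) : List A → Set where
  bar : ∀ {L} → (∀ x → P x → All (λ y → ¬ R y x) L → Bar R P (x ∷ L)) → Bar R P L

module _ {A : Set} {R : A → A → Set} where

  Bar-⊆ : ∀ {P L L′} → L Subset.⊆ L′ → Bar R P L → Bar R P L′
  Bar-⊆ L⊆L′ (bar next) = bar λ x px bad →
    Bar-⊆ (∷⁺ʳ x L⊆L′) (next x px (anti-mono L⊆L′ bad))

  Bar-weaken : ∀ {P Q L} → (∀ {x} → Q x → P x) → Bar R P L → Bar R Q L
  Bar-weaken Q⇒P (bar next) = bar λ x qx bad → Bar-weaken Q⇒P (next x (Q⇒P qx) bad)

  Bar-∪ : ∀ {P Q L} → Bar R P L → Bar R Q L → Bar R (P ∪ Q) L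
  Bar-∪ p q = go p ⊆-refl q
    where
    go : ∀ {P Q L L′} → Bar R P L → L Subset.⊆ L′ → Bar R Q L′ → Bar R (P ∪ Q) L′
    go p@(bar nextP) L⊆L′ q@(bar nextQ) = bar λ x → [
      (λ px bad → go (nextP x px (anti-mono L⊆L′ bad)) (∷⁺ʳ x L⊆L′)
                     (Bar-⊆ (xs⊆x∷xs _ x) q)) ,
      (λ qx bad → go p (⊆-trans L⊆L′ (xs⊆x∷xs _ x)) (nextQ x qx bad)) ]

  Bar-∃Fin : ∀ {n L} {P : Fin n → Pred A _} →
             (∀ i → Bar R (P i) L) → Bar R (λ x → ∃[ i ] P i x) L
  Bar-∃Fin {zero}  bars = bar λ { x (() , _) _ }
  Bar-∃Fin {suc n} {P = P} bars =
    Bar-weaken split (Bar-∪ (bars zero) (Bar-∃Fin (bars ∘ suc)))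
    where
    split : ∀ {x} → ∃[ i ] P i x → P zero x ⊎ ∃[ i ] P (suc i) x
    split (zero  , p) = inj₁ p
    split (suc i , p) = inj₂ (i , p)

  -- Once x₀ has occurred, every later element of a bad sequence is not above x₀.
  Bar-U : ∀ {x₀ L} → x₀ ∈ L → Bar R (λ x → ¬ R x₀ x) L → Bar R U L
  Bar-U x₀∈L (bar next) = bar λ x _ bad →
    Bar-U (there x₀∈L) (next x (All.lookup bad x₀∈L) bad)

  Bar-reflect : ∀ {B : Set} {R′ : B → B → Set} {P : Pred B _} (f : B → A) →
                (∀ {y x} → P y → P x → R (f y) (f x) → R′ y x) →
                ∀ {L} → Bar R U (map f L) → All P L → Bar R′ P L
  Bar-reflect f reflects (bar next) PL = bar λ x px bad →
    let bad′ = All.zipWith (λ (py , ¬R′) → ¬R′ ∘ reflects py px) (PL , bad)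
    in Bar-reflect f reflects (next (f x) tt (map⁺ bad′)) (px ∷ PL)

⊑-refl : ∀ {p} {M : Marking p} → M ⊑ M
⊑-refl i = ≤-refl

⊑-trans : ∀ {p} {M M′ M″ : Marking p} → M ⊑ M′ → M′ ⊑ M″ → M ⊑ M″
⊑-trans M⊑M′ M′⊑M″ i = ≤-trans (M⊑M′ i) (M′⊑M″ i)

_⊑?_ : ∀ {p} → Decidable (_⊑_ {p})
M ⊑? M′ = all? (λ i → M i ≤? M′ i)

⊑-from-removeAt : ∀ {p} (i : Fin (suc p)) {y x : Marking (suc p)} →
                  y i ≤ x i → removeAt y i ⊑ removeAt x i → y ⊑ x
⊑-from-removeAt i {y} {x} yi≤xi y⊑x j with i Fin.≟ j
... | yes refl = yi≤xi
... | no  i≢j  = subst (λ k → y k ≤ x k) (punchIn-punchOut i≢j) (y⊑x (punchOut i≢j))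

-- Dickson's lemma. After a first element x₀, a bad sequence stays in the finite union of
-- the slices {x | x i ≡ c} with c < x₀ i, each of which is ordered like Marking p.
dickson : ∀ p → Bar (_⊑_ {p}) U []
dickson zero    = bar λ _ _ _ → bar λ _ _ bad → ⊥-elim (All.head bad λ ())
dickson (suc p) = bar λ x₀ _ _ →
  Bar-U (here refl)
    (Bar-weaken (belowSomewhere x₀) (Bar-∃Fin λ i → Bar-∃Fin λ c → slice i (toℕ c)))
  where
  slice : ∀ i c {L} → Bar _⊑_ (λ x → x i ≡ c) L
  slice i c = Bar-⊆ (λ ()) (Bar-reflect (λ x → removeAt x i)
    (λ yi≡c xi≡c → ⊑-from-removeAt i (≤-reflexive (trans yi≡c (sym xi≡c)))) (dickson p) [])

  belowSomewhere : ∀ x₀ {x} → ¬ x₀ ⊑ x → ∃[ i ] ∃[ c ] x i ≡ toℕ {x₀ i} c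
  belowSomewhere x₀ {x} x₀⋢x with ¬∀⟶∃¬ _ (λ i → x₀ i ≤ x i) (λ i → x₀ i ≤? x i) x₀⋢x
  ... | i , x₀i≰xi = i , fromℕ< (≰⇒> x₀i≰xi) , sym (toℕ-fromℕ< (≰⇒> x₀i≰xi))

n∸m≤n∸o⇒o≤m : ∀ {m n o} → o ≤ n → n ∸ m ≤ n ∸ o → o ≤ m
n∸m≤n∸o⇒o≤m {m} {n} {o} o≤n le with o ≤? m
... | yes o≤m = o≤m
... | no  o≰m = contradiction le (<⇒≱ (∸-monoʳ-< (≰⇒> o≰m) o≤n))

module _ {A : Set} where

  drop≡[]⇒length≤ : ∀ k (xs : List A) → drop k xs ≡ [] → length xs ≤ k
  drop≡[]⇒length≤ k xs eq = m∸n≡0⇒m≤n (trans (sym (length-drop k xs)) (cong length eq))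

  drop≡∷⇒< : ∀ k (xs : List A) {x ys} → drop k xs ≡ x ∷ ys → k < length xs
  drop≡∷⇒< zero    (_ ∷ _)  _  = s≤s z≤n
  drop≡∷⇒< (suc k) (_ ∷ xs) eq = s≤s (drop≡∷⇒< k xs eq)

  drop-view : ∀ k (xs : List A) → drop k xs ≡ [] ⊎ ∃[ x ] drop k xs ≡ x ∷ drop (suc k) xs
  drop-view zero    []       = inj₁ refl
  drop-view zero    (x ∷ xs) = inj₂ (x , refl)
  drop-view (suc k) []       = inj₁ refl
  drop-view (suc k) (_ ∷ xs) = drop-view k xs

-- State k of the matcher means that the suffix drop k w has been matched.
module GreedySuffixMatch {A : Set} (_≟_ : DecidableEquality A) (w : List A) where

  Next : ℕ → A → Set
  Next k a = drop k w ≡ a ∷ drop (suc k) w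

  next? : ∀ k a → Dec (Next k a)
  next? k a = ≡-dec _≟_ _ _

  advance : ℕ → A → ℕ
  advance zero    a = zero
  advance (suc k) a with next? k a
  ... | yes _ = k
  ... | no  _ = suc k

  retreat : ℕ → A → ℕ
  retreat k a with next? k a
  ... | yes _ = suc k
  ... | no  _ = k

  advance-suc-next : ∀ {k a} → Next k a → advance (suc k) a ≡ k
  advance-suc-next {k} {a} next with next? k a
  ... | yes _     = refl
  ... | no  ¬next = contradiction next ¬next

  advance-suc-¬next : ∀ {k a} → ¬ Next k a → advance (suc k) a ≡ suc k
  advance-suc-¬next {k} {a} ¬next with next? k a
  ... | yes next = contradiction next ¬next
  ... | no  _    = refl

  advance-≤ : ∀ k a → advance k a ≤ k
  advance-≤ zero    a = z≤n
  advance-≤ (suc k) a with next? k a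
  ... | yes _ = n≤1+n k
  ... | no  _ = ≤-refl

  ≤-suc-advance : ∀ k a → k ≤ suc (advance k a)
  ≤-suc-advance zero    a = z≤n
  ≤-suc-advance (suc k) a with next? k a
  ... | yes _ = ≤-refl
  ... | no  _ = n≤1+n (suc k)

  advance-mono : ∀ {j k} a → j ≤ k → advance j a ≤ advance k a
  advance-mono {j} {k} a j≤k with m≤n⇒m<n∨m≡n j≤k
  ... | inj₁ j<k  = ≤-trans (advance-≤ j a) (≤-pred (≤-trans j<k (≤-suc-advance k a)))
  ... | inj₂ refl = ≤-refl

  advance-next-≤ : ∀ {j k a} → Next k a → j ≤ suc k → advance j a ≤ k
  advance-next-≤ {j} {k} {a} next j≤1+k with m≤n⇒m<n∨m≡n j≤1+k
  ... | inj₁ j<1+k = ≤-trans (advance-≤ j a) (≤-pred j<1+k)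
  ... | inj₂ refl  = ≤-reflexive (advance-suc-next next)

  advance-¬next-≤ : ∀ {j k a} → ¬ Next k a → advance j a ≤ k → j ≤ k
  advance-¬next-≤ {j} {k} {a} ¬next adv≤k with m≤n⇒m<n∨m≡n (≤-trans (≤-suc-advance j a) (s≤s adv≤k))
  ... | inj₁ j<1+k = ≤-pred j<1+k
  ... | inj₂ refl  = contradiction (subst (_≤ k) (advance-suc-¬next ¬next) adv≤k) 1+n≰n

  advance-retreat-≤ : ∀ k a → advance (retreat k a) a ≤ k
  advance-retreat-≤ k a with next? k a
  ... | yes next = advance-next-≤ next ≤-refl
  ... | no  _    = advance-≤ k a

  ≤-retreat : ∀ {j k} a → advance j a ≤ k → j ≤ retreat k a
  ≤-retreat {j} {k} a adv≤k with next? k a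
  ... | yes _     = ≤-trans (≤-suc-advance j a) (s≤s adv≤k)
  ... | no  ¬next = advance-¬next-≤ ¬next adv≤k

  retreat-≤-length : ∀ a {k} → k ≤ length w → retreat k a ≤ length w
  retreat-≤-length a {k} k≤n with next? k a
  ... | yes next = drop≡∷⇒< k w next
  ... | no  _    = k≤n

  matched : List A → ℕ
  matched []      = length w
  matched (a ∷ h) = advance (matched h) a

  matched-≤-length : ∀ h → matched h ≤ length w
  matched-≤-length []      = ≤-refl
  matched-≤-length (a ∷ h) = ≤-trans (advance-≤ (matched h) a) (matched-≤-length h)

  drop-advance-⊆ : ∀ k a {h} → drop k w ⊆ h → drop (advance k a) w ⊆ a ∷ h
  drop-advance-⊆ zero    a q = a ∷ʳ q
  drop-advance-⊆ (suc k) a q with next? k a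
  ... | yes next = subst (_⊆ a ∷ _) (sym next) (refl ∷ q)
  ... | no  _    = a ∷ʳ q

  drop-matched-⊆ : ∀ h → drop (matched h) w ⊆ h
  drop-matched-⊆ []      = subst (_⊆ []) (sym (drop-all (length w) w ≤-refl)) []
  drop-matched-⊆ (a ∷ h) = drop-advance-⊆ (matched h) a (drop-matched-⊆ h)

  matched-least : ∀ k h → drop k w ⊆ h → matched h ≤ k
  matched-least k h q with drop-view k w
  ... | inj₁ done      = ≤-trans (matched-≤-length h) (drop≡[]⇒length≤ k w done)
  ... | inj₂ (_ , next) = cons h next (subst (_⊆ h) next q)
    where
    cons : ∀ h {b} → Next k b → b ∷ drop (suc k) w ⊆ h → matched h ≤ k
    cons (a ∷ h) next (.a ∷ʳ q′) =
      ≤-trans (advance-≤ (matched h) a) (matched-least k h (subst (_⊆ h) (sym next) q′))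
    cons (a ∷ h) next (refl ∷ q′) = advance-next-≤ next (matched-least (suc k) h q′)

-- A well-structured transition system on the Bounded states with an effective
-- predecessor basis, in the sense of Finkel and Schnoebelen.
module BackwardCoverability
  {S : Set} (_≼_ : S → S → Set) (≼-refl : Reflexive _≼_) (≼-trans : Transitive _≼_)
  (_≼?_ : Decidable _≼_)
  (_⟶_ : S → S → Set)
  (⟶-compatible : ∀ {s u s′} → s ≼ u → s ⟶ s′ → ∃[ u′ ] u ⟶ u′ × s′ ≼ u′)
  {m : ℕ} (minPre : Fin m → S → S)
  (minPre-⟶ : ∀ t b → ∃[ s ] minPre t b ⟶ s × b ≼ s)
  (minPre-least : ∀ {s s′ b} → s ⟶ s′ → b ≼ s′ → ∃[ t ] minPre t b ≼ s)
  (Bounded : Pred S _) (minPre-bounded : ∀ t {b} → Bounded b → Bounded (minPre t b))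
  (bounded-bar : Bar _≼_ Bounded [])
  (target : S) (target-bounded : Bounded target)
  where

  Coverable : Pred S _
  Coverable s = ∃[ s′ ] Star _⟶_ s s′ × target ≼ s′

  ↑ : List S → Pred S _
  ↑ L s = Any (_≼ s) L

  ↑? : ∀ L s → Dec (↑ L s)
  ↑? L s = Any.any? (_≼? s) L

  Closed : List S → Set
  Closed L = ∀ t → All (↑ L ∘ minPre t) L

  ⟶*-compatible : ∀ {s u s′} → s ≼ u → Star _⟶_ s s′ → ∃[ u′ ] Star _⟶_ u u′ × s′ ≼ u′
  ⟶*-compatible s≼u ε = _ , ε , s≼u
  ⟶*-compatible s≼u (first ◅ rest) =
    let _ , first′ , s₁≼u₁ = ⟶-compatible s≼u first
        _ , rest′ , s′≼u′ = ⟶*-compatible s₁≼u₁ rest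
    in _ , first′ ◅ rest′ , s′≼u′

  coverable-upward : ∀ {s u} → s ≼ u → Coverable s → Coverable u
  coverable-upward s≼u (_ , run , target≼s′) =
    let _ , run′ , s′≼u′ = ⟶*-compatible s≼u run in _ , run′ , ≼-trans target≼s′ s′≼u′

  coverable-minPre : ∀ t {b} → Coverable b → Coverable (minPre t b)
  coverable-minPre t {b} cov =
    let _ , first , b≼s = minPre-⟶ t b
        _ , rest , target≼s′ = coverable-upward b≼s cov
    in _ , first ◅ rest , target≼s′

  ↑-coverable : ∀ {L s} → All Coverable L → ↑ L s → Coverable s
  ↑-coverable covs up = let _ , b∈L , b≼s = find up in coverable-upward b≼s (All.lookup covs b∈L)

  ↑-upward : ∀ {L s u} → ↑ L s → s ≼ u → ↑ L u
  ↑-upward up s≼u = Any.map (λ b≼s → ≼-trans b≼s s≼u) up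

  ↑-⟶*-backward : ∀ {L s s′} → Closed L → Star _⟶_ s s′ → ↑ L s′ → ↑ L s
  ↑-⟶*-backward closed ε              up = up
  ↑-⟶*-backward closed (first ◅ rest) up =
    let _ , b∈L , b≼s₁ = find (↑-⟶*-backward closed rest up)
        t , minPre≼s = minPre-least first b≼s₁
    in ↑-upward (All.lookup (closed t) b∈L) minPre≼s

  Closed? : ∀ L → Dec (Closed L)
  Closed? L = all? λ t → All.all? (↑? L ∘ minPre t) L

  violation : ∀ {L} → ¬ Closed L → ∃[ t ] ∃[ b ] b ∈ L × ¬ ↑ L (minPre t b)
  violation {L} ¬closed =
    let t , ¬all = ¬∀⟶∃¬ m _ (λ t → All.all? (↑? L ∘ minPre t) L) ¬closed
    in t , find (¬All⇒Any¬ (↑? L ∘ minPre t) L ¬all)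

  -- Terminates because each added element lies above no earlier one.
  saturate : ∀ {L} → Bar _≼_ Bounded L → All (Coverable ∩ Bounded) L → ↑ L target →
             ∃[ L′ ] Closed L′ × All Coverable L′ × ↑ L′ target
  saturate {L} (bar next) inv up with Closed? L
  ... | yes closed = L , closed , All.map proj₁ inv , up
  ... | no ¬closed =
    let t , b , b∈L , ¬up = violation ¬closed
        cov , bounded = All.lookup inv b∈L
        bounded′ = minPre-bounded t bounded
    in saturate (next (minPre t b) bounded′ (¬Any⇒All¬ L ¬up))
                ((coverable-minPre t cov , bounded′) ∷ inv) (there up)

  coverableBasis : ∃[ L ] ↑ L ≐ Coverable
  coverableBasis =
    let L , closed , covs , up = saturate (Bar-⊆ (λ ()) bounded-bar)
                                          (((target , ε , ≼-refl) , target-bounded) ∷ [])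
                                          (here ≼-refl)
    in L , ↑-coverable covs ,
       λ (_ , run , target≼s′) → ↑-⟶*-backward closed run (↑-upward up target≼s′)

  coverable? : ∀ s → Dec (Coverable s)
  coverable? s = let L , ↑⊆cov , cov⊆↑ = coverableBasis in map′ ↑⊆cov cov⊆↑ (↑? L s)

module _ (N : PetriNet) where

  firePreimage : Fin (transitions N) → Marking (places N) → Marking (places N)
  firePreimage t b i = pre N t i + (b i ∸ post N t i)

  fire-mono : ∀ t {M M′} → M ⊑ M′ → fire N t M ⊑ fire N t M′
  fire-mono t M⊑M′ i = +-monoˡ-≤ (post N t i) (∸-monoˡ-≤ (pre N t i) (M⊑M′ i))

  pre⊑firePreimage : ∀ t b → pre N t ⊑ firePreimage t b
  pre⊑firePreimage t b i = m≤m+n (pre N t i) (b i ∸ post N t i)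

  ⊑-fire-firePreimage : ∀ t b → b ⊑ fire N t (firePreimage t b)
  ⊑-fire-firePreimage t b i = begin
    b i
      ≤⟨ m≤n+m∸n (b i) (post N t i) ⟩
    post N t i + (b i ∸ post N t i)
      ≡⟨ +-comm (post N t i) _ ⟩
    (b i ∸ post N t i) + post N t i
      ≡⟨ cong (_+ post N t i) (m+n∸m≡n (pre N t i) _) ⟨
    pre N t i + (b i ∸ post N t i) ∸ pre N t i + post N t i ∎
    where open ≤-Reasoning

  firePreimage-least : ∀ t {b M} → pre N t ⊑ M → b ⊑ fire N t M → firePreimage t b ⊑ M
  firePreimage-least t {b} {M} pre⊑M b⊑fire i = begin
    pre N t i + (b i ∸ post N t i)
      ≤⟨ +-monoʳ-≤ (pre N t i) (∸-monoˡ-≤ (post N t i) (b⊑fire i)) ⟩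
    pre N t i + ((M i ∸ pre N t i) + post N t i ∸ post N t i)
      ≡⟨ cong (pre N t i +_) (m+n∸n≡m _ (post N t i)) ⟩
    pre N t i + (M i ∸ pre N t i)
      ≡⟨ m+[n∸m]≡n (pre⊑M i) ⟩
    M i ∎
    where open ≤-Reasoning

module HistoryAbstraction (N : PetriNet) (w : History N) (M₁ : Marking (places N)) where
  open GreedySuffixMatch Fin._≟_ w

  State : Set
  State = Marking (places N) × ℕ

  data _⟶_ : State → State → Set where
    fire-step : ∀ t {M k} → pre N t ⊑ M → (M , k) ⟶ (fire N t M , advance k t)

  _≼_ : State → State → Set
  (M , k) ≼ (M′ , k′) = M ⊑ M′ × k′ ≤ k

  ≼-refl : Reflexive _≼_
  ≼-refl = ⊑-refl , ≤-refl

  ≼-trans : Transitive _≼_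
  ≼-trans (M⊑M′ , k′≤k) (M′⊑M″ , k″≤k′) = ⊑-trans M⊑M′ M′⊑M″ , ≤-trans k″≤k′ k′≤k

  _≼?_ : Decidable _≼_
  (M , k) ≼? (M′ , k′) = (M ⊑? M′) ×-dec (k′ ≤? k)

  ⟶-compatible : ∀ {s u s′} → s ≼ u → s ⟶ s′ → ∃[ u′ ] u ⟶ u′ × s′ ≼ u′
  ⟶-compatible (M⊑M′ , k′≤k) (fire-step t pre⊑M) =
    _ , fire-step t (⊑-trans pre⊑M M⊑M′) , fire-mono N t M⊑M′ , advance-mono t k′≤k

  minPre : Fin (transitions N) → State → State
  minPre t (b , k) = firePreimage N t b , retreat k t

  minPre-⟶ : ∀ t b → ∃[ s ] minPre t b ⟶ s × b ≼ s
  minPre-⟶ t (b , k) =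
    _ , fire-step t (pre⊑firePreimage N t b) , ⊑-fire-firePreimage N t b , advance-retreat-≤ k t

  minPre-least : ∀ {s s′ b} → s ⟶ s′ → b ≼ s′ → ∃[ t ] minPre t b ≼ s
  minPre-least (fire-step t pre⊑M) (b⊑fire , adv≤k) =
    t , firePreimage-least N t pre⊑M b⊑fire , ≤-retreat t adv≤k

  Bounded : Pred State _
  Bounded (_ , k) = k ≤ length w

  minPre-bounded : ∀ t {b} → Bounded b → Bounded (minPre t b)
  minPre-bounded t = retreat-≤-length t

  -- The matcher coordinate enters Dickson's lemma as the number of matched letters.
  embed : State → Marking (suc (places N))
  embed (M , k) = (length w ∸ k) ◂ M

  embed-reflects : ∀ {y x} → Bounded y → Bounded x → embed y ⊑ embed x → y ≼ x
  embed-reflects _ kx≤n le = (λ i → le (suc i)) , n∸m≤n∸o⇒o≤m kx≤n (le zero)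

  bounded-bar : Bar _≼_ Bounded []
  bounded-bar = Bar-reflect embed embed-reflects (dickson (suc (places N))) []

  open BackwardCoverability _≼_ ≼-refl ≼-trans _≼?_ _⟶_ ⟶-compatible minPre minPre-⟶ minPre-least
    Bounded minPre-bounded bounded-bar (M₁ , 0) z≤n public

  abstractConfig : Config N → State
  abstractConfig (M , h) = M , matched h

  abstractRun : ∀ {c c′} → _▷*_ {N} c c′ → Star _⟶_ (abstractConfig c) (abstractConfig c′)
  abstractRun ε                     = ε
  abstractRun (step t pre⊑M ◅ rest) = fire-step t pre⊑M ◅ abstractRun rest

  concreteRun : ∀ {s′} c → Star _⟶_ (abstractConfig c) s′ →
                ∃[ c′ ] _▷*_ {N} c c′ × abstractConfig c′ ≡ s′
  concreteRun c ε = c , ε , refl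
  concreteRun (M , h) (fire-step t pre⊑M ◅ rest) =
    let c′ , run , eq = concreteRun (fire N t M , t ∷ h) rest in c′ , step t pre⊑M ◅ run , eq

  coverable⇔historyCoverable : Coverable (M₀ N , length w) ⇔ HistoryCoverable N M₁ w
  coverable⇔historyCoverable = mk⇔ from to
    where
    from : Coverable (M₀ N , length w) → HistoryCoverable N M₁ w
    from (_ , run , M₁⊑M , k≤0) with concreteRun (M₀ N , []) run
    ... | (M , h) , run′ , refl =
      M , h , run′ , M₁⊑M , subst (λ k → drop k w ⊆ h) (n≤0⇒n≡0 k≤0) (drop-matched-⊆ h)

    to : HistoryCoverable N M₁ w → Coverable (M₀ N , length w)
    to (M , h , run , M₁⊑M , w⊆h) =
      (M , matched h) , abstractRun run , M₁⊑M , matched-least 0 h w⊆h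

mainTheorem4 : (N : PetriNet) (M₁ : Marking (places N)) (w : History N) →
    Dec (HistoryCoverable N M₁ w)
mainTheorem4 N M₁ w =
  Dec.map coverable⇔historyCoverable (coverable? (M₀ N , length w))
  where open HistoryAbstraction N w M₁
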